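{- Let $(\omega,\tau)$ be a strongly irresolvable space. Then the ideal $\mathsf{nwd}(\tau)$ of $\tau$-nowhere dense subsets of $\omega$ is saturated.
   Context: A space is irresolvable if it has no dense subset with dense complement; strongly irresolvable if every open subset, with the subspace topology, is irresolvable. An ideal $\mathscr{I}$ on $\omega$ is saturated if $\mathcal{P}(\omega)/\mathscr{I}$ is c.c.c. -}

module Defs where

open import Level using (Level; 0ℓ) renaming (suc to lsuc)
open import Data.Nat using (ℕ)
open import Data.Product using (Σ; _×_; _,_; ∃)
open import Relation.Nullary using (¬_)
open import Relation.Binary.PropositionalEquality using (_≡_)
open import Function.Definitions using (Injective)
open import Axiom.ExcludedMiddle using (ExcludedMiddle)

-- Subsets of ω = ℕ, as predicates.
Subset : Set₁
Subset = ℕ → Set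

_∈_ : ℕ → Subset → Set
x ∈ A = A x

_⊆_ : Subset → Subset → Set
A ⊆ B = ∀ x → A x → B x

_∩_ : Subset → Subset → Subset
(A ∩ B) x = A x × B x

_∖_ : Subset → Subset → Subset
(A ∖ B) x = A x × ¬ B x

⋃ : (I : Set) → (I → Subset) → Subset
⋃ I F x = Σ I λ i → F i x

∅ : Subset
∅ _ = Data.Empty.⊥ where import Data.Empty

univ : Subset
univ _ = Data.Unit.⊤ where import Data.Unit

Nonempty : Subset → Set
Nonempty A = ∃ λ x → A x

record Topology : Set₂ where
  field
    IsOpen   : Subset → Set₁
    open-ext : ∀ {A B} → A ⊆ B → B ⊆ A → IsOpen A → IsOpen B
    open-∅   : IsOpen ∅
    open-univ : IsOpen univ
    open-∩   : ∀ {A B} → IsOpen A → IsOpen B → IsOpen (A ∩ B)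
    open-⋃   : (I : Set) (F : I → Subset) → (∀ i → IsOpen (F i)) → IsOpen (⋃ I F)

module _ (τ : Topology) where
  open Topology τ

  InClosure : Subset → ℕ → Set₁
  InClosure A x = (U : Subset) → IsOpen U → U x → Nonempty (U ∩ A)

  NowhereDense : Subset → Set₁
  NowhereDense A = (U : Subset) → IsOpen U → (∀ x → U x → InClosure A x) → ¬ Nonempty U

  DenseIn : Subset → Subset → Set₁
  DenseIn U D = (V : Subset) → IsOpen V → Nonempty (V ∩ U) → Nonempty ((V ∩ U) ∩ D)

  IrresolvableSub : Subset → Set₁
  IrresolvableSub U = ¬ (Σ Subset λ D → D ⊆ U × DenseIn U D × DenseIn U (U ∖ D))

  StronglyIrresolvable : Set₁
  StronglyIrresolvable = (U : Subset) → IsOpen U → Nonempty U → IrresolvableSub U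

  -- An antichain in P(ω)/nwd(τ), given as an indexed family of
  -- representatives: each is nwd-positive (nonzero class) and distinct
  -- members are incompatible (intersection in the ideal).
  IsNwdAntichain : (I : Set) → (I → Subset) → Set₁
  IsNwdAntichain I A =
    (∀ i → ¬ NowhereDense (A i)) ×
    (∀ i j → ¬ i ≡ j → NowhereDense (A i ∩ A j))

  -- nwd(τ) is saturated: P(ω)/nwd(τ) is c.c.c., i.e. every antichain is
  -- countable (injects into ℕ).
  NwdSaturated : Set₁
  NwdSaturated = (I : Set) (A : I → Subset) → IsNwdAntichain I A →
                 Σ (I → ℕ) λ f → Injective _≡_ _≡_ f

{-# OPTIONS --safe #-}
module Submission where

-- In a strongly irresolvable space every somewhere dense set A has an
-- interior point: otherwise, on a nonempty open U ⊆ cl A, both A ∩ U and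
-- U ∖ A would be dense in U. Picking an interior point of each member of an
-- antichain injects the antichain into ω, because a common interior point of
-- A i and A j has an open neighbourhood inside A i ∩ A j, which is then not
-- nowhere dense.

open import Defs
open import Level using (Level)
open import Axiom.ExcludedMiddle using (ExcludedMiddle)
open import Axiom.DoubleNegationElimination using (DoubleNegationElimination; em⇒dne)
open import Data.Nat using (ℕ)
open import Data.Product using (Σ; _×_; _,_; proj₁; proj₂)
open import Relation.Nullary using (¬_)
open import Relation.Binary.PropositionalEquality using (_≡_; subst; sym)
open import Function.Definitions using (Injective)

module _ (τ : Topology) where
  open Topology τ

  InInterior : Subset → ℕ → Set₁
  InInterior A x = Σ Subset λ U → IsOpen U × U ⊆ A × U x

  ∈⇒InClosure : ∀ {A x} → A x → InClosure τ A x
  ∈⇒InClosure {x = x} Ax U _ Ux = x , Ux , Ax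

  commonInteriorPoint⇒¬NowhereDense : ∀ {A B x} → InInterior A x → InInterior B x →
                                      ¬ NowhereDense τ (A ∩ B)
  commonInteriorPoint⇒¬NowhereDense {x = x} (U , oU , U⊆A , Ux) (V , oV , V⊆B , Vx) nwd =
    nwd (U ∩ V) (open-∩ oU oV)
        (λ z (Uz , Vz) → ∈⇒InClosure (U⊆A z Uz , V⊆B z Vz))
        (x , Ux , Vx)

  DenseIn-mono : ∀ {U B C} → B ⊆ C → DenseIn τ U B → DenseIn τ U C
  DenseIn-mono B⊆C denseB V oV VU≠∅ =
    let z , VUz , Bz = denseB V oV VU≠∅ in z , VUz , B⊆C z Bz

  ⊆closure⇒DenseIn : ∀ {U A} → IsOpen U → (∀ x → U x → InClosure τ A x) →
                     DenseIn τ U (A ∩ U)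
  ⊆closure⇒DenseIn {U} oU U⊆clA V oV (y , Vy , Uy) =
    let z , (Vz , Uz) , Az = U⊆clA y Uy (V ∩ U) (open-∩ oV oU) (Vy , Uy)
    in z , (Vz , Uz) , (Az , Uz)

module Classical (dne : ∀ {ℓ} → DoubleNegationElimination ℓ) where

  ¬⊆⇒Nonempty-∖ : ∀ {A B} → ¬ (A ⊆ B) → Nonempty (A ∖ B)
  ¬⊆⇒Nonempty-∖ A⊈B = dne λ A∖B≡∅ → A⊈B λ x Ax → dne λ ¬Bx → A∖B≡∅ (x , Ax , ¬Bx)

  module _ (τ : Topology) where
    open Topology τ

    emptyInterior⇒DenseIn-∖ : ∀ {A U} → ¬ Σ ℕ (InInterior τ A) → IsOpen U →
                              DenseIn τ U (U ∖ A)
    emptyInterior⇒DenseIn-∖ {U = U} noInterior oU V oV (y , VUy) =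
      let z , (Vz , Uz) , ¬Az = ¬⊆⇒Nonempty-∖ λ VU⊆A →
                                  noInterior (y , V ∩ U , open-∩ oV oU , VU⊆A , VUy)
      in z , (Vz , Uz) , (Uz , ¬Az)

    ¬NowhereDense⇒interiorPoint : StronglyIrresolvable τ → ∀ {A} → ¬ NowhereDense τ A →
                                  Σ ℕ (InInterior τ A)
    ¬NowhereDense⇒interiorPoint irresolvable {A} somewhereDense =
      dne λ noInterior → somewhereDense λ U oU U⊆clA U≠∅ →
        irresolvable U oU U≠∅
          ( A ∩ U
          , (λ _ → proj₂)
          , ⊆closure⇒DenseIn τ oU U⊆clA
          , DenseIn-mono τ (λ _ (Uz , ¬Az) → Uz , λ AUz → ¬Az (proj₁ AUz))
                           (emptyInterior⇒DenseIn-∖ noInterior oU))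

    stronglyIrresolvable⇒NwdSaturated : StronglyIrresolvable τ → NwdSaturated τ
    stronglyIrresolvable⇒NwdSaturated irresolvable I A (positive , incompatible) =
      point , point-injective
      where
      interiorPoint : ∀ i → Σ ℕ (InInterior τ (A i))
      interiorPoint i = ¬NowhereDense⇒interiorPoint irresolvable (positive i)

      point : I → ℕ
      point i = proj₁ (interiorPoint i)

      point-injective : Injective _≡_ _≡_ point
      point-injective {i} {j} samePoint = dne λ i≢j →
        commonInteriorPoint⇒¬NowhereDense τ
          (proj₂ (interiorPoint i))
          (subst (InInterior τ (A j)) (sym samePoint) (proj₂ (interiorPoint j)))
          (incompatible i j i≢j)

mainTheorem12 : (lem : ∀ {ℓ : Level} → ExcludedMiddle ℓ) →
    (τ : Topology) → StronglyIrresolvable τ → NwdSaturated τ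
mainTheorem12 lem = Classical.stronglyIrresolvable⇒NwdSaturated (em⇒dne lem)
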